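{- Let $\mathcal{T}$ be a tanglegram having exactly one cross-responsible set $X$, and assume $\mathcal{T}[X]$ is isomorphic to $\mathcal{K}_1$. Then for every $m\in\sigma_{\mathcal{T}}\setminus X$, neither the left-scar nor the right-scar of $m$ in $\mathcal{T}[X]$ lies on a leaf-edge (an edge incident to a leaf) of $\mathcal{T}[X]$.
   Context: A rooted tree is a tree with at least two vertices and a designated root of degree $1$; leaves are non-root vertices of degree $1$; a rooted binary tree is a rooted tree in which all non-root, non-leaf vertices have degree $3$. For a set $S$ of leaves of a rooted binary tree $T$, $T\llbracket S\rrbracket$ is the union of the root-to-$s$ paths for $s\in S$, and $T[S]$ is obtained from $T\llbracket S\rrbracket$ by suppressing degree-$2$ vertices; each edge $e$ of $T[S]$ corresponds to a path $P_e$ of $T\llbracket S\rrbracket$. For a leaf $w\notin S$, the scar of $w$ in $T[S]$ is on edge $e$ if the first vertex of $T\llbracket S\rrbracket$ met by the path from $w$ to the root is an interior vertex of $P_e$. A tanglegram $\mathcal{T}=(L_{\mathcal{T}},R_{\mathcal{T}},\sigma_{\mathcal{T}})$ consists of two rooted binary trees with equally many leaves and a perfect matching $\sigma_{\mathcal{T}}$ between their leaf sets. For $Z\subseteq\sigma_{\mathcal{T}}$, $\mathcal{T}[Z]$ has left tree $L_{\mathcal{T}}[S_1]$, right tree $R_{\mathcal{T}}[S_2]$ and matching $Z$, where $S_1,S_2$ are the left and right leaves covered by $Z$. Tanglegrams are isomorphic if there is a graph isomorphism mapping left root to left root and right root to right root. For $m\in\sigma_{\mathcal{T}}\setminus Z$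 with left endpoint $\mu_1$ and right endpoint $\mu_2$, its left-scar in $\mathcal{T}[Z]$ is the scar of $\mu_1$ in $L_{\mathcal{T}}[S_1]$ and its right-scar is the scar of $\mu_2$ in $R_{\mathcal{T}}[S_2]$. $\mathcal{K}_1$ is the size-$4$ tanglegram in which each tree has root adjacent to an internal vertex whose two children each have two leaf children, with left cherries $\{l_1,l_2\},\{l_3,l_4\}$, right cherries $\{r_1,r_2\},\{r_3,r_4\}$ and matching $l_1r_1, l_2r_3, l_3r_2, l_4r_4$. $\mathcal{K}_2$ is the size-$4$ tanglegram whose left tree is: root adjacent to $v_1$, $v_1$ has children leaf $l_1$ and $v_2$, $v_2$ has children leaf $l_2$ and $v_3$, $v_3$ has leaf children $l_3,l_4$; right tree analogously with $w_1,w_2,w_3$ and leaves $r_1$ (child of $w_1$), $r_2$ (child of $w_2$), $r_3,r_4$ (children of $w_3$); matching $l_1r_4, l_2r_2, l_3r_3, l_4r_1$. A set $Y\subseteq\sigma_{\mathcal{T}}$ is cross-responsible if $\mathcal{T}[Y]$ is isomorphic to $\mathcal{K}_1$ or $\mathcal{K}_2$. -}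

module Defs where

open import Data.Nat using (ℕ)
open import Data.Fin using (Fin; zero; suc)
open import Data.Fin.Subset using (Subset; _∈_; _∉_)
open import Data.Bool using (Bool; true; false; if_then_else_)
open import Data.Vec using (lookup)
open import Data.List using (List; []; _∷_; _++_; allFin)
open import Data.List.Relation.Unary.Any using (Any)
open import Data.List.Relation.Binary.Permutation.Propositional using (_↭_)
open import Data.Maybe using (Maybe; just; nothing)
open import Data.Product using (Σ; _×_; ∃; ∃-syntax)
open import Data.Sum using (_⊎_)
open import Relation.Binary.PropositionalEquality using (_≡_)
open import Relation.Nullary using (¬_)

-- A value of Tree A is the part of a planted rooted binary tree below
-- its (degree-1) root: `leaf a` is the tree root–a, and `node l r` is an
-- internal (degree-3) vertex with children subtrees l and r, whose
-- parent is the root (at top level) or another internal vertex.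
-- Children are unordered; order is quotiented out by _≅_ below.

data Tree (A : Set) : Set where
  leaf : A → Tree A
  node : Tree A → Tree A → Tree A

leaves : {A : Set} → Tree A → List A
leaves (leaf a)   = a ∷ []
leaves (node l r) = leaves l ++ leaves r

mapT : {A B : Set} → (A → B) → Tree A → Tree B
mapT f (leaf a)   = leaf (f a)
mapT f (node l r) = node (mapT f l) (mapT f r)

data _≅_ {A : Set} : Tree A → Tree A → Set where
  leaf≅ : (a : A) → leaf a ≅ leaf a
  node≅ : {l r l' r' : Tree A} → l ≅ l' → r ≅ r' → node l r ≅ node l' r'
  swap≅ : {l r l' r' : Tree A} → l ≅ r' → r ≅ l' → node l r ≅ node l' r'

-- Tanglegrams of size n.  Matching edges are identified with Fin n:
-- the matching edge i joins the left leaf labelled i to the right leaf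
-- labelled i.  Each tree carries each label exactly once.

record Tanglegram (n : ℕ) : Set where
  field
    left         : Tree (Fin n)
    right        : Tree (Fin n)
    left-leaves  : leaves left ↭ allFin n
    right-leaves : leaves right ↭ allFin n
open Tanglegram public

-- T[S]: keep the root-to-s paths for s ∈ S, then suppress degree-2
-- vertices (nothing if S contains no leaf of T).

restrict : {n : ℕ} → Subset n → Tree (Fin n) → Maybe (Tree (Fin n))
restrict S (leaf a) = if lookup S a then just (leaf a) else nothing
restrict S (node l r) with restrict S l | restrict S r
... | just l' | just r' = just (node l' r')
... | just l' | nothing = just l'
... | nothing | just r' = just r'
... | nothing | nothing = nothing

-- A graph isomorphism fixing the sides maps
-- matched pairs to matched pairs, so it is a relabelling φ of matching
-- edges under which both restricted trees become isomorphic to K's.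

RestrictIso : {n k : ℕ} → Tanglegram n → Subset n →
              Tree (Fin k) → Tree (Fin k) → Set
RestrictIso {n} {k} 𝒯 Z KL KR =
  Σ (Fin n → Fin k) λ φ →
    (Σ (Tree (Fin n)) λ tL → restrict Z (left 𝒯) ≡ just tL × mapT φ tL ≅ KL) ×
    (Σ (Tree (Fin n)) λ tR → restrict Z (right 𝒯) ≡ just tR × mapT φ tR ≅ KR)

-- Labels: 0,1,2,3 stand for l₁,l₂,l₃,l₄; each right leaf carries the label
-- of its matched left leaf.

l₁ l₂ l₃ l₄ : Fin 4
l₁ = zero
l₂ = suc zero
l₃ = suc (suc zero)
l₄ = suc (suc (suc zero))

-- 𝒦₁: matching l₁r₁, l₂r₃, l₃r₂, l₄r₄; right cherries {r₁,r₂},{r₃,r₄}.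
K₁-left K₁-right : Tree (Fin 4)
K₁-left  = node (node (leaf l₁) (leaf l₂)) (node (leaf l₃) (leaf l₄))
K₁-right = node (node (leaf l₁) (leaf l₃)) (node (leaf l₂) (leaf l₄))
--               r₁ ↔ l₁    r₂ ↔ l₃           r₃ ↔ l₂    r₄ ↔ l₄

-- 𝒦₂: caterpillars; matching l₁r₄, l₂r₂, l₃r₃, l₄r₁.
K₂-left K₂-right : Tree (Fin 4)
K₂-left  = node (leaf l₁) (node (leaf l₂) (node (leaf l₃) (leaf l₄)))
K₂-right = node (leaf l₄) (node (leaf l₂) (node (leaf l₃) (leaf l₁)))
--               r₁ ↔ l₄        r₂ ↔ l₂        r₃ ↔ l₃    r₄ ↔ l₁

CrossResponsible : {n : ℕ} → Tanglegram n → Subset n → Set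
CrossResponsible 𝒯 Y = RestrictIso 𝒯 Y K₁-left K₁-right ⊎ RestrictIso 𝒯 Y K₂-left K₂-right

-- Vertices of T as positions.  The root is a separate vertex above the
-- position [] (the child of the root); other vertices are positions.

data Dir : Set where
  L R : Dir

Pos : Set
Pos = List Dir

at : {A : Set} → Tree A → Pos → Maybe (Tree A)
at t          []       = just t
at (leaf a)   (_ ∷ _)  = nothing
at (node l r) (L ∷ ps) = at l ps
at (node l r) (R ∷ ps) = at r ps

Prefix : Pos → Pos → Set
Prefix p q = Σ Pos λ ds → q ≡ p ++ ds

StrictPrefix : Pos → Pos → Set
StrictPrefix p q = Σ Dir λ d → Σ Pos λ ds → q ≡ p ++ (d ∷ ds)

HasLeafIn : {n : ℕ} → Subset n → Tree (Fin n) → Set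
HasLeafIn S t = Any (_∈ S) (leaves t)

-- the non-root vertex at p belongs to T⟦S⟧
InSpan : {n : ℕ} → Subset n → Tree (Fin n) → Pos → Set
InSpan {n} S T p = Σ (Tree (Fin n)) λ t → at T p ≡ just t × HasLeafIn S t

LeafAt : {A : Set} → Tree A → A → Pos → Set
LeafAt T a p = at T p ≡ just (leaf a)

-- vertex at p has degree 3 in T⟦S⟧ (the only non-root, non-leaf vertices
-- of T⟦S⟧ that are not suppressed in T[S])
Branching : {n : ℕ} → Subset n → Tree (Fin n) → Pos → Set
Branching {n} S T p =
  Σ (Tree (Fin n)) λ l → Σ (Tree (Fin n)) λ r →
    at T p ≡ just (node l r) × HasLeafIn S l × HasLeafIn S r

-- FirstMet S T pw v: the first vertex of T⟦S⟧ on the path from the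
-- vertex at pw to the root is v (just p = position p; nothing = root).
FirstMet : {n : ℕ} → Subset n → Tree (Fin n) → Pos → Maybe Pos → Set
FirstMet S T pw (just v) =
  Prefix v pw × InSpan S T v × (∀ u → Prefix u pw → InSpan S T u → Prefix u v)
FirstMet S T pw nothing = ∀ u → Prefix u pw → ¬ InSpan S T u

-- UpperEnd S T q e: for the leaf s ∈ S at position q, the edge of T[S]
-- incident to s corresponds to the path P_e from s up to e, the nearest
-- strict ancestor of s that is kept in T[S] (a branching vertex, or the
-- root = nothing).
UpperEnd : {n : ℕ} → Subset n → Tree (Fin n) → Pos → Maybe Pos → Set
UpperEnd S T q (just u) =
  StrictPrefix u q × Branching S T u ×
  (∀ u' → StrictPrefix u' q → Branching S T u' → Prefix u' u)
UpperEnd S T q nothing = ∀ u' → StrictPrefix u' q → ¬ Branching S T u'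

Interior : Maybe Pos → Pos → Pos → Set
Interior nothing  v q = StrictPrefix v q
Interior (just u) v q = StrictPrefix u v × StrictPrefix v q

ScarOnLeafEdge : {n : ℕ} → Subset n → Tree (Fin n) → Fin n → Set
ScarOnLeafEdge S T w =
  Σ Pos λ pw → LeafAt T w pw ×
  Σ (Maybe Pos) λ v → FirstMet S T pw v ×
  ∃[ s ] (s ∈ S × Σ Pos λ q → LeafAt T s q ×
    Σ (Maybe Pos) λ e → UpperEnd S T q e ×
    Σ Pos λ v' → v ≡ just v' × Interior e v' q)

{-# OPTIONS --safe #-}
-- Suppose the left-scar of m lies on the leaf-edge of s ∈ X. Then in L[X ∪ {m}] the leaves m
-- and s form a cherry, and both trees of 𝒯[X ∪ {m}] arise from those of 𝒦₁ by inserting one new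
-- leaf. There are finitely many such pairs of insertions, and a computation shows that each pair
-- in which the new leaf lies in a cherry of the left tree restricts, on four leaves including the
-- new one, to 𝒦₁ or 𝒦₂. Pulling those four leaves back to 𝒯 gives a cross-responsible set
-- containing m, which therefore differs from X. Exchanging the two trees of 𝒯 maps 𝒦₁ and 𝒦₂ to
-- relabelled copies of themselves, which handles the right-scar.
module Submission where

open import Defs
open import Data.Nat using (ℕ; zero; suc)
open import Data.Fin using (Fin; zero; suc; fromℕ; inject₁; pinch; punchIn; _≟_)
open import Data.Fin.Subset using (Subset; _∈_; _∉_; _⊆_; inside; _∩_; ∁; ⁅_⁆)
open import Data.Fin.Subset.Properties using (_∈?_; p∩q⊆p; x∈p∩q⁺)
open import Data.Fin.Permutation.Components using (transpose)
open import Data.Bool using (Bool; true; false; T; _∧_; _∨_)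
open import Data.Bool.Properties using (T-∨)
open import Data.Bool.ListAction using (all)
open import Data.Unit using (tt)
open import Data.Vec using (lookup; tabulate; _[_]≔_)
open import Data.Vec.Properties
  using ([]=⇒lookup; lookup⇒[]=; lookup∘tabulate; lookup-zipWith; lookup∘updateAt′; []≔-updates)
open import Data.Vec.Functional using (updateAt)
open import Data.Vec.Functional.Properties using (updateAt-updates; updateAt-minimal)
open import Data.List using (List; []; _∷_; _++_; map; concatMap; allFin; mapMaybe; head)
open import Data.List.Properties using (++-assoc; ++-identityʳ; ++-cancelˡ)
open import Data.List.Membership.Propositional using (lose) renaming (_∈_ to _∈ₗ_; _∉_ to _∉ₗ_)
open import Data.List.Membership.Propositional.Properties
  using (∈-++⁺ˡ; ∈-++⁺ʳ; ∈-++⁻; ∈-map⁺; ∈-allFin)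
open import Data.List.Relation.Unary.Any using (here; there)
import Data.List.Relation.Unary.Any.Properties as Any
import Data.List.Relation.Unary.All as All
import Data.List.Relation.Unary.All.Properties as All
open import Data.List.Relation.Unary.AllPairs using (_∷_)
open import Data.List.Relation.Unary.Unique.Propositional using (Unique; [])
open import Data.List.Relation.Unary.Unique.Propositional.Properties using (allFin⁺)
open import Data.List.Relation.Binary.Disjoint.Propositional using (Disjoint)
open import Data.List.Relation.Binary.Permutation.Propositional using (_↭_; ↭-sym; ↭⇒↭ₛ)
open import Data.List.Relation.Binary.Permutation.Propositional.Properties using (Any-resp-↭)
import Data.List.Relation.Binary.Permutation.Setoid.Properties as Permutationₛ
open import Data.Maybe using (Maybe; just; nothing; _>>=_; _<∣>_; zip; is-just; to-witness-T)
import Data.Maybe as Maybe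
open import Data.Maybe.Relation.Unary.Any using (just) renaming (Any to AnyMaybe)
open import Data.Maybe.Relation.Binary.Pointwise using (Pointwise; just; nothing)
open import Data.Product using (Σ; _×_; _,_; proj₁; proj₂; ∃)
open import Data.Sum using (_⊎_; inj₁; inj₂; [_,_]′)
import Data.Sum as Sum
open import Data.Empty using (⊥)
open import Function using (_∘_; const)
open import Function.Bundles using (Equivalence)
open import Relation.Binary.PropositionalEquality
  using (_≡_; refl; sym; trans; cong; cong₂; subst; subst₂; setoid; module ≡-Reasoning)
open import Relation.Nullary using (¬_; yes; no; contradiction)
open import Relation.Nullary.Decidable using (⌊_⌋; fromWitness)

private
  variable
    A B C : Set
    j k n : ℕ

≅-trans : {t u v : Tree A} → t ≅ u → u ≅ v → t ≅ v
≅-trans (leaf≅ a)   (leaf≅ .a)  = leaf≅ a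
≅-trans (node≅ p q) (node≅ r s) = node≅ (≅-trans p r) (≅-trans q s)
≅-trans (node≅ p q) (swap≅ r s) = swap≅ (≅-trans p r) (≅-trans q s)
≅-trans (swap≅ p q) (node≅ r s) = swap≅ (≅-trans p s) (≅-trans q r)
≅-trans (swap≅ p q) (swap≅ r s) = node≅ (≅-trans p s) (≅-trans q r)

module _ (f : A → B) where

  mapT-≅ : {t u : Tree A} → t ≅ u → mapT f t ≅ mapT f u
  mapT-≅ (leaf≅ a)   = leaf≅ (f a)
  mapT-≅ (node≅ p q) = node≅ (mapT-≅ p) (mapT-≅ q)
  mapT-≅ (swap≅ p q) = swap≅ (mapT-≅ p) (mapT-≅ q)

  mapT-cong : {g : A → B} (t : Tree A) → (∀ {a} → a ∈ₗ leaves t → f a ≡ g a) → mapT f t ≡ mapT g t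
  mapT-cong (leaf a)   f≗g = cong leaf (f≗g (here refl))
  mapT-cong (node l r) f≗g =
    cong₂ node (mapT-cong l (f≗g ∘ ∈-++⁺ˡ)) (mapT-cong r (f≗g ∘ ∈-++⁺ʳ (leaves l)))

mapT-∘ : (g : B → C) (f : A → B) (t : Tree A) → mapT g (mapT f t) ≡ mapT (g ∘ f) t
mapT-∘ g f (leaf a)   = refl
mapT-∘ g f (node l r) = cong₂ node (mapT-∘ g f l) (mapT-∘ g f r)

leaves-Unique : (t : Tree (Fin n)) → leaves t ↭ allFin n → Unique (leaves t)
leaves-Unique {n} t t↭ = Permutationₛ.Unique-resp-↭ (setoid (Fin n)) (↭⇒↭ₛ (↭-sym t↭)) (allFin⁺ n)

leaves-complete : (t : Tree (Fin n)) → leaves t ↭ allFin n → (a : Fin n) → a ∈ₗ leaves t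
leaves-complete t t↭ a = Any-resp-↭ (↭-sym t↭) (∈-allFin a)

-- Restriction

merge : Maybe (Tree A) → Maybe (Tree A) → Maybe (Tree A)
merge (just l) (just r) = just (node l r)
merge (just l) nothing  = just l
merge nothing  y        = y

merge-≅ : {x x′ y y′ : Maybe (Tree A)} →
          Pointwise _≅_ x x′ → Pointwise _≅_ y y′ → Pointwise _≅_ (merge x y) (merge x′ y′)
merge-≅ (just p) (just q) = just (node≅ p q)
merge-≅ (just p) nothing  = just p
merge-≅ nothing  q        = q

merge-≅-swap : {x x′ y y′ : Maybe (Tree A)} →
               Pointwise _≅_ x y′ → Pointwise _≅_ y x′ → Pointwise _≅_ (merge x y) (merge x′ y′)
merge-≅-swap (just p) (just q) = just (swap≅ p q)
merge-≅-swap (just p) nothing  = just p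
merge-≅-swap nothing  (just q) = just q
merge-≅-swap nothing  nothing  = nothing

map-merge : (f : A → B) (x y : Maybe (Tree A)) →
            Maybe.map (mapT f) (merge x y) ≡ merge (Maybe.map (mapT f) x) (Maybe.map (mapT f) y)
map-merge f (just _) (just _) = refl
map-merge f (just _) nothing  = refl
map-merge f nothing  _        = refl


restrict-node : (S : Subset n) (l r : Tree (Fin n)) →
                restrict S (node l r) ≡ merge (restrict S l) (restrict S r)
restrict-node S l r with restrict S l | restrict S r
... | just _  | just _  = refl
... | just _  | nothing = refl
... | nothing | just _  = refl
... | nothing | nothing = refl

restrict-leaf-∈ : {S : Subset n} {a : Fin n} → a ∈ S → restrict S (leaf a) ≡ just (leaf a)
restrict-leaf-∈ a∈S rewrite []=⇒lookup a∈S = refl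

restrict-empty : (S : Subset n) (t : Tree (Fin n)) → ¬ HasLeafIn S t → restrict S t ≡ nothing
restrict-empty S (leaf a) a∉S with lookup S a in eq
... | true  = contradiction (here (lookup⇒[]= a S eq)) a∉S
... | false = refl
restrict-empty S (node l r) noLeaf rewrite restrict-node S l r
  | restrict-empty S l (noLeaf ∘ Any.++⁺ˡ) | restrict-empty S r (noLeaf ∘ Any.++⁺ʳ (leaves l)) = refl

restrict-⊆ : (S : Subset n) (t : Tree (Fin n)) {w : Tree (Fin n)} → restrict S t ≡ just w →
             ∀ {a} → a ∈ₗ leaves w → a ∈ S
restrict-⊆ S (leaf b) eq a∈w with lookup S b in e
restrict-⊆ S (leaf b) refl (here refl) | true = lookup⇒[]= b S e
restrict-⊆ S (node l r) eq a∈w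
  with restrict S l in el | restrict S r in er | trans (sym (restrict-node S l r)) eq
... | just l′ | just r′ | refl = [ restrict-⊆ S l el , restrict-⊆ S r er ]′ (∈-++⁻ (leaves l′) a∈w)
... | just l′ | nothing | refl = restrict-⊆ S l el a∈w
... | nothing | just r′ | refl = restrict-⊆ S r er a∈w

restrict-cong : (S S′ : Subset n) (t : Tree (Fin n)) →
                (∀ {a} → a ∈ₗ leaves t → lookup S a ≡ lookup S′ a) → restrict S t ≡ restrict S′ t
restrict-cong S S′ (leaf a)   S≗S′ rewrite S≗S′ (here refl) = refl
restrict-cong S S′ (node l r) S≗S′ rewrite restrict-node S l r | restrict-node S′ l r =
  cong₂ merge (restrict-cong S S′ l (S≗S′ ∘ ∈-++⁺ˡ))
              (restrict-cong S S′ r (S≗S′ ∘ ∈-++⁺ʳ (leaves l)))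

restrict-mapT : (ψ : Fin n → Fin k) (S : Subset n) (S′ : Subset k) (t : Tree (Fin n)) →
                (∀ {a} → a ∈ₗ leaves t → lookup S a ≡ lookup S′ (ψ a)) →
                Maybe.map (mapT ψ) (restrict S t) ≡ restrict S′ (mapT ψ t)
restrict-mapT ψ S S′ (leaf a) S≗S′ rewrite S≗S′ (here refl) with lookup S′ (ψ a)
... | true  = refl
... | false = refl
restrict-mapT ψ S S′ (node l r) S≗S′
  rewrite restrict-node S l r | restrict-node S′ (mapT ψ l) (mapT ψ r) =
  trans (map-merge ψ (restrict S l) (restrict S r))
        (cong₂ merge (restrict-mapT ψ S S′ l (S≗S′ ∘ ∈-++⁺ˡ))
                     (restrict-mapT ψ S S′ r (S≗S′ ∘ ∈-++⁺ʳ (leaves l))))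

restrict-≅ : (S : Subset n) {t u : Tree (Fin n)} → t ≅ u → Pointwise _≅_ (restrict S t) (restrict S u)
restrict-≅ S (leaf≅ a) with lookup S a
... | true  = just (leaf≅ a)
... | false = nothing
restrict-≅ S (node≅ {l} {r} {l′} {r′} p q) rewrite restrict-node S l r | restrict-node S l′ r′ =
  merge-≅ (restrict-≅ S p) (restrict-≅ S q)
restrict-≅ S (swap≅ {l} {r} {l′} {r′} p q) rewrite restrict-node S l r | restrict-node S l′ r′ =
  merge-≅-swap (restrict-≅ S p) (restrict-≅ S q)

bind-merge : (Y : Subset n) (x y : Maybe (Tree (Fin n))) →
             merge (x >>= restrict Y) (y >>= restrict Y) ≡ (merge x y >>= restrict Y)
bind-merge Y (just a) (just b) = sym (restrict-node Y a b)
bind-merge Y (just a) nothing with restrict Y a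
... | just _  = refl
... | nothing = refl
bind-merge Y nothing _ = refl

restrict-restrict : {Y S : Subset n} → Y ⊆ S → (t : Tree (Fin n)) →
                    restrict Y t ≡ (restrict S t >>= restrict Y)
restrict-restrict {Y = Y} {S = S} Y⊆S (leaf a) with lookup S a in inS
... | true  = refl
... | false with lookup Y a in inY
...   | false = refl
...   | true with () ← trans (sym ([]=⇒lookup (Y⊆S (lookup⇒[]= a Y inY)))) inS
restrict-restrict {Y = Y} {S = S} Y⊆S (node l r) rewrite restrict-node Y l r | restrict-node S l r =
  trans (cong₂ merge (restrict-restrict Y⊆S l) (restrict-restrict Y⊆S r))
        (bind-merge Y (restrict S l) (restrict S r))

-- Inserting a leaf

data Insertion (m : A) : Tree A → Tree A → Set where
  hereˡ  : {t : Tree A} → Insertion m t (node (leaf m) t)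
  hereʳ  : {t : Tree A} → Insertion m t (node t (leaf m))
  thereˡ : {l l′ r : Tree A} → Insertion m l l′ → Insertion m (node l r) (node l′ r)
  thereʳ : {l r r′ : Tree A} → Insertion m r r′ → Insertion m (node l r) (node l r′)

Insertionᴹ : A → Maybe (Tree A) → Maybe (Tree A) → Set
Insertionᴹ m nothing  t′        = t′ ≡ just (leaf m)
Insertionᴹ m (just t) (just t′) = Insertion m t t′
Insertionᴹ m (just t) nothing   = ⊥

Insertionᴹ-mergeˡ : {m : A} {x x′ : Maybe (Tree A)} (y : Maybe (Tree A)) →
                    Insertionᴹ m x x′ → Insertionᴹ m (merge x y) (merge x′ y)
Insertionᴹ-mergeˡ {x = nothing} (just _) refl = hereˡ
Insertionᴹ-mergeˡ {x = nothing} nothing  refl = refl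
Insertionᴹ-mergeˡ {x = just _} {just _} (just _) i = thereˡ i
Insertionᴹ-mergeˡ {x = just _} {just _} nothing  i = i

Insertionᴹ-mergeʳ : {m : A} (x : Maybe (Tree A)) {y y′ : Maybe (Tree A)} →
                    Insertionᴹ m y y′ → Insertionᴹ m (merge x y) (merge x y′)
Insertionᴹ-mergeʳ nothing  i = i
Insertionᴹ-mergeʳ (just _) {nothing} refl = hereʳ
Insertionᴹ-mergeʳ (just _) {just _} {just _} i = thereʳ i

Insertion-mapT : (f : A → B) {m : A} {t t′ : Tree A} →
                 Insertion m t t′ → Insertion (f m) (mapT f t) (mapT f t′)
Insertion-mapT f hereˡ      = hereˡ
Insertion-mapT f hereʳ      = hereʳ
Insertion-mapT f (thereˡ i) = thereˡ (Insertion-mapT f i)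
Insertion-mapT f (thereʳ i) = thereʳ (Insertion-mapT f i)

Insertion-≅ : {m : A} {t t′ u : Tree A} → Insertion m t t′ → t ≅ u →
              Σ (Tree A) λ u′ → Insertion m u u′ × t′ ≅ u′
Insertion-≅ {m = m} hereˡ t≅u = _ , hereˡ , node≅ (leaf≅ m) t≅u
Insertion-≅ {m = m} hereʳ t≅u = _ , hereʳ , node≅ t≅u (leaf≅ m)
Insertion-≅ (thereˡ i) (node≅ p q) with u′ , i′ , e ← Insertion-≅ i p = _ , thereˡ i′ , node≅ e q
Insertion-≅ (thereˡ i) (swap≅ p q) with u′ , i′ , e ← Insertion-≅ i p = _ , thereʳ i′ , swap≅ e q
Insertion-≅ (thereʳ i) (node≅ p q) with u′ , i′ , e ← Insertion-≅ i q = _ , thereʳ i′ , node≅ p e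
Insertion-≅ (thereʳ i) (swap≅ p q) with u′ , i′ , e ← Insertion-≅ i q = _ , thereˡ i′ , swap≅ p e

insertions : A → Tree A → List (Tree A)
insertionsBelow : A → Tree A → List (Tree A)
insertions m t = node (leaf m) t ∷ node t (leaf m) ∷ insertionsBelow m t
insertionsBelow m (leaf _)   = []
insertionsBelow m (node l r) = map (λ l′ → node l′ r) (insertions m l) ++ map (node l) (insertions m r)

insertions-complete : {m : A} {t t′ : Tree A} → Insertion m t t′ → t′ ∈ₗ insertions m t
insertions-complete hereˡ = here refl
insertions-complete hereʳ = there (here refl)
insertions-complete (thereˡ i) = there (there (∈-++⁺ˡ (∈-map⁺ _ (insertions-complete i))))
insertions-complete {m = m} (thereʳ {l = l} i) =
  there (there (∈-++⁺ʳ (map _ (insertions m l)) (∈-map⁺ _ (insertions-complete i))))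

-- Cherries

data Cherry (a b : A) : Tree A → Set where
  cherryᵃᵇ : Cherry a b (node (leaf a) (leaf b))
  cherryᵇᵃ : Cherry a b (node (leaf b) (leaf a))
  thereˡ   : {l r : Tree A} → Cherry a b l → Cherry a b (node l r)
  thereʳ   : {l r : Tree A} → Cherry a b r → Cherry a b (node l r)

Cherry-≅ : {a b : A} {t u : Tree A} → Cherry a b t → t ≅ u → Cherry a b u
Cherry-≅ cherryᵃᵇ   (node≅ (leaf≅ _) (leaf≅ _)) = cherryᵃᵇ
Cherry-≅ cherryᵃᵇ   (swap≅ (leaf≅ _) (leaf≅ _)) = cherryᵇᵃ
Cherry-≅ cherryᵇᵃ   (node≅ (leaf≅ _) (leaf≅ _)) = cherryᵇᵃ
Cherry-≅ cherryᵇᵃ   (swap≅ (leaf≅ _) (leaf≅ _)) = cherryᵃᵇ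
Cherry-≅ (thereˡ c) (node≅ p q) = thereˡ (Cherry-≅ c p)
Cherry-≅ (thereˡ c) (swap≅ p q) = thereʳ (Cherry-≅ c p)
Cherry-≅ (thereʳ c) (node≅ p q) = thereʳ (Cherry-≅ c q)
Cherry-≅ (thereʳ c) (swap≅ p q) = thereˡ (Cherry-≅ c q)

Cherry-mapT : (f : A → B) {a b : A} {t : Tree A} → Cherry a b t → Cherry (f a) (f b) (mapT f t)
Cherry-mapT f cherryᵃᵇ   = cherryᵃᵇ
Cherry-mapT f cherryᵇᵃ   = cherryᵇᵃ
Cherry-mapT f (thereˡ c) = thereˡ (Cherry-mapT f c)
Cherry-mapT f (thereʳ c) = thereʳ (Cherry-mapT f c)

Cherry-mergeˡ : {a b : A} {x : Maybe (Tree A)} (y : Maybe (Tree A)) →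
                AnyMaybe (Cherry a b) x → AnyMaybe (Cherry a b) (merge x y)
Cherry-mergeˡ (just _) (just c) = just (thereˡ c)
Cherry-mergeˡ nothing  (just c) = just c

Cherry-mergeʳ : {a b : A} (x : Maybe (Tree A)) {y : Maybe (Tree A)} →
                AnyMaybe (Cherry a b) y → AnyMaybe (Cherry a b) (merge x y)
Cherry-mergeʳ (just _) (just c) = just (thereʳ c)
Cherry-mergeʳ nothing  c        = c

restrict-Cherry-at : (S : Subset n) (T : Tree (Fin n)) (p : Pos) {t : Tree (Fin n)} {a b : Fin n} →
                     at T p ≡ just t → AnyMaybe (Cherry a b) (restrict S t) → AnyMaybe (Cherry a b) (restrict S T)
restrict-Cherry-at S T          []      refl c = c
restrict-Cherry-at S (node l r) (L ∷ p) eq   c rewrite restrict-node S l r =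
  Cherry-mergeˡ (restrict S r) (restrict-Cherry-at S l p eq c)
restrict-Cherry-at S (node l r) (R ∷ p) eq   c rewrite restrict-node S l r =
  Cherry-mergeʳ (restrict S l) (restrict-Cherry-at S r p eq c)

-- Positions and scars

Unique-++⁻ : (xs : List A) {ys : List A} → Unique (xs ++ ys) → Unique xs × Unique ys × Disjoint xs ys
Unique-++⁻ []       u        = [] , u , λ ()
Unique-++⁻ (x ∷ xs) (x∉ ∷ u)
  with x∉xs , x∉ys ← All.++⁻ xs x∉ | uxs , uys , xs#ys ← Unique-++⁻ xs u =
  x∉xs ∷ uxs , uys , λ { (here refl , x∈ys) → All.lookup x∉ys x∈ys refl
                       ; (there a∈xs , a∈ys) → xs#ys (a∈xs , a∈ys) }

at-++ : (T : Tree A) (p : Pos) {t : Tree A} → at T p ≡ just t → (q : Pos) → at T (p ++ q) ≡ at t q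
at-++ T          []      refl q = refl
at-++ (node l r) (L ∷ p) eq   q = at-++ l p eq q
at-++ (node l r) (R ∷ p) eq   q = at-++ r p eq q

at-prefix : (T : Tree A) (p q : Pos) {t′ : Tree A} → at T (p ++ q) ≡ just t′ → ∃ λ t → at T p ≡ just t
at-prefix T          []      q eq = T , refl
at-prefix (node l r) (L ∷ p) q eq = at-prefix l p q eq
at-prefix (node l r) (R ∷ p) q eq = at-prefix r p q eq

LeafAt⇒∈leaves : (t : Tree A) (p : Pos) {a : A} → LeafAt t a p → a ∈ₗ leaves t
LeafAt⇒∈leaves (leaf a)   []      refl = here refl
LeafAt⇒∈leaves (node l r) (L ∷ p) eq   = ∈-++⁺ˡ (LeafAt⇒∈leaves l p eq)
LeafAt⇒∈leaves (node l r) (R ∷ p) eq   = ∈-++⁺ʳ (leaves l) (LeafAt⇒∈leaves r p eq)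

Unique-at : (T : Tree A) (p : Pos) {t : Tree A} → at T p ≡ just t → Unique (leaves T) → Unique (leaves t)
Unique-at T          []      refl u = u
Unique-at (node l r) (L ∷ p) eq   u = Unique-at l p eq (proj₁ (Unique-++⁻ (leaves l) u))
Unique-at (node l r) (R ∷ p) eq   u = Unique-at r p eq (proj₁ (proj₂ (Unique-++⁻ (leaves l) u)))

Prefix-trans : {p q r : Pos} → Prefix p q → Prefix q r → Prefix p r
Prefix-trans {p} (ds , refl) (es , refl) = ds ++ es , ++-assoc p ds es

StrictPrefix⇒¬Prefix : {p q : Pos} → StrictPrefix p q → ¬ Prefix q p
StrictPrefix⇒¬Prefix {p} (d , ds , refl) (es , eq)
  with () ← ++-cancelˡ p [] (d ∷ ds ++ es) (trans (++-identityʳ p) (trans eq (++-assoc p (d ∷ ds) es)))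

Interior⇒StrictPrefix : (e : Maybe Pos) {v q : Pos} → Interior e v q → StrictPrefix v q
Interior⇒StrictPrefix nothing  v<q       = v<q
Interior⇒StrictPrefix (just _) (_ , v<q) = v<q

module _ (S : Subset n) where

  HasLeafIn-at : (t : Tree (Fin n)) (p : Pos) {s : Fin n} → LeafAt t s p → s ∈ S → HasLeafIn S t
  HasLeafIn-at t p at-s s∈S = lose (LeafAt⇒∈leaves t p at-s) s∈S

  unbranched-below : (T : Tree (Fin n)) {q v : Pos} (e : Maybe Pos) → UpperEnd S T q e → Interior e v q →
                     ∀ p → StrictPrefix (v ++ p) q → ¬ Branching S T (v ++ p)
  unbranched-below T {v = v} nothing  none _ p v++p<q = none (v ++ p) v++p<q
  unbranched-below T (just u) (_ , _ , below-u) (u<v , _) p v++p<q br =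
    StrictPrefix⇒¬Prefix u<v (Prefix-trans (p , refl) (below-u _ v++p<q br))

  restrict-unbranched : (t : Tree (Fin n)) (q : Pos) {s : Fin n} → LeafAt t s q → s ∈ S →
                        (∀ p → StrictPrefix p q → ¬ Branching S t p) → restrict S t ≡ just (leaf s)
  restrict-unbranched (leaf s)   []      refl s∈S _ = restrict-leaf-∈ s∈S
  restrict-unbranched (node l r) (L ∷ q) at-s s∈S unbranched
    rewrite restrict-node S l r
          | restrict-unbranched l q at-s s∈S
              (λ p (d , ds , eq) → unbranched (L ∷ p) (d , ds , cong (L ∷_) eq))
          | restrict-empty S r λ r-has →
              unbranched [] (L , q , refl) (l , r , refl , HasLeafIn-at l q at-s s∈S , r-has)
    = refl
  restrict-unbranched (node l r) (R ∷ q) at-s s∈S unbranched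
    rewrite restrict-node S l r
          | restrict-unbranched r q at-s s∈S
              (λ p (d , ds , eq) → unbranched (R ∷ p) (d , ds , cong (R ∷_) eq))
          | restrict-empty S l λ l-has →
              unbranched [] (R , q , refl) (l , r , refl , l-has , HasLeafIn-at r q at-s s∈S)
    = refl

module _ (X : Subset n) {m : Fin n} (m∉X : m ∉ X) where

  restrict-away : (t : Tree (Fin n)) → m ∉ₗ leaves t → restrict (X [ m ]≔ inside) t ≡ restrict X t
  restrict-away t m∉t = restrict-cong _ X t λ {a} a∈t → lookup∘updateAt′ a m (λ { refl → m∉t a∈t }) X

  restrict-insert : (t : Tree (Fin n)) → Unique (leaves t) → m ∈ₗ leaves t →
                    Insertionᴹ m (restrict X t) (restrict (X [ m ]≔ inside) t)
  restrict-insert (leaf m) _ (here refl)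
    rewrite restrict-empty X (leaf m) (λ { (here m∈X) → m∉X m∈X }) | restrict-leaf-∈ ([]≔-updates X m)
    = refl
  restrict-insert (node l r) u m∈t with ul , ur , l#r ← Unique-++⁻ (leaves l) u | ∈-++⁻ (leaves l) m∈t
  ... | inj₁ m∈l
    rewrite restrict-node X l r | restrict-node (X [ m ]≔ inside) l r
          | restrict-away r (λ m∈r → l#r (m∈l , m∈r))
    = Insertionᴹ-mergeˡ (restrict X r) (restrict-insert l ul m∈l)
  ... | inj₂ m∈r
    rewrite restrict-node X l r | restrict-node (X [ m ]≔ inside) l r
          | restrict-away l (λ m∈l → l#r (m∈l , m∈r))
    = Insertionᴹ-mergeʳ (restrict X l) (restrict-insert r ur m∈r)

  sibling-restrictions : (c₁ c₂ : Tree (Fin n)) {s : Fin n} → Disjoint (leaves c₁) (leaves c₂) →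
                         Unique (leaves c₂) → m ∈ₗ leaves c₂ →
                         restrict X c₁ ≡ just (leaf s) → ¬ HasLeafIn X c₂ →
                         restrict (X [ m ]≔ inside) c₁ ≡ just (leaf s) ×
                         restrict (X [ m ]≔ inside) c₂ ≡ just (leaf m)
  sibling-restrictions c₁ c₂ c₁#c₂ u₂ m∈c₂ c₁↦s no-X =
    trans (restrict-away c₁ λ m∈c₁ → c₁#c₂ (m∈c₁ , m∈c₂)) c₁↦s ,
    subst (λ x → Insertionᴹ m x (restrict (X [ m ]≔ inside) c₂))
          (restrict-empty X c₂ no-X) (restrict-insert c₂ u₂ m∈c₂)

  cherry-at-fork : (t : Tree (Fin n)) (d : Dir) (q ds : Pos) {s : Fin n} → Unique (leaves t) →
                   LeafAt t s (d ∷ q) → s ∈ X → LeafAt t m ds →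
                   (∀ d′ q′ → Prefix (d′ ∷ q′) ds → ¬ InSpan X t (d′ ∷ q′)) →
                   (∀ p → StrictPrefix p (d ∷ q) → ¬ Branching X t p) →
                   AnyMaybe (Cherry m s) (restrict (X [ m ]≔ inside) t)
  cherry-at-fork (node l r) L q (L ∷ q′) _ at-s s∈X _ off-span _ =
    contradiction (l , refl , HasLeafIn-at X l q at-s s∈X) (off-span L [] (q′ , refl))
  cherry-at-fork (node l r) R q (R ∷ q′) _ at-s s∈X _ off-span _ =
    contradiction (r , refl , HasLeafIn-at X r q at-s s∈X) (off-span R [] (q′ , refl))
  cherry-at-fork (node l r) L q (R ∷ q′) u at-s s∈X at-m off-span unbranched
    with ul , ur , l#r ← Unique-++⁻ (leaves l) u
    with l↦s , r↦m ← sibling-restrictions l r l#r ur (LeafAt⇒∈leaves r q′ at-m)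
           (restrict-unbranched X l q at-s s∈X
              λ p (d , ds , eq) → unbranched (L ∷ p) (d , ds , cong (L ∷_) eq))
           (λ r-has → off-span R [] (q′ , refl) (r , refl , r-has))
    rewrite restrict-node (X [ m ]≔ inside) l r | l↦s | r↦m = just cherryᵇᵃ
  cherry-at-fork (node l r) R q (L ∷ q′) u at-s s∈X at-m off-span unbranched
    with ul , ur , l#r ← Unique-++⁻ (leaves l) u
    with r↦s , l↦m ← sibling-restrictions r l (λ (a∈r , a∈l) → l#r (a∈l , a∈r)) ul
                       (LeafAt⇒∈leaves l q′ at-m)
           (restrict-unbranched X r q at-s s∈X
              λ p (d , ds , eq) → unbranched (R ∷ p) (d , ds , cong (R ∷_) eq))
           (λ l-has → off-span L [] (q′ , refl) (l , refl , l-has))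
    rewrite restrict-node (X [ m ]≔ inside) l r | l↦m | r↦s = just cherryᵃᵇ

  -- The first vertex v of T⟦X⟧ above m lies on the leaf-edge of s, so below v the path to s does not
  -- branch, while the side of v towards m carries no leaf of X: in T[X ∪ {m}], m and s form a cherry.
  scar⇒cherry : (T : Tree (Fin n)) → Unique (leaves T) → ScarOnLeafEdge X T m →
                ∃ λ s → AnyMaybe (Cherry m s) (restrict (X [ m ]≔ inside) T)
  scar⇒cherry T uT (_ , at-m , _ , (v≤pw , _ , first) , s , s∈X , _ , at-s , e , upper , v , refl , interior)
    with Interior⇒StrictPrefix e interior | v≤pw
  ... | d , q , refl | ds , refl with t , at-v ← at-prefix T v (d ∷ q) at-s =
    s , restrict-Cherry-at _ T v at-v
          (cherry-at-fork t d q ds (Unique-at T v at-v uT) (local at-s) s∈X (local at-m) off-span unbranched)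
    where
    local : {a : Fin n} {p : Pos} → LeafAt T a (v ++ p) → LeafAt t a p
    local {p = p} = trans (sym (at-++ T v at-v p))

    off-span : ∀ d′ q′ → Prefix (d′ ∷ q′) ds → ¬ InSpan X t (d′ ∷ q′)
    off-span d′ q′ (es , eq) (t′ , at-t′ , has) =
      StrictPrefix⇒¬Prefix (d′ , q′ , refl)
        (first (v ++ d′ ∷ q′) (es , trans (cong (v ++_) eq) (sym (++-assoc v (d′ ∷ q′) es)))
               (t′ , trans (at-++ T v at-v (d′ ∷ q′)) at-t′ , has))

    unbranched : ∀ p → StrictPrefix p (d ∷ q) → ¬ Branching X t p
    unbranched p (d₀ , ds₀ , eq) (l , r , at-p , hl , hr) =
      unbranched-below X T e upper interior p
        (d₀ , ds₀ , trans (cong (v ++_) eq) (sym (++-assoc v p (d₀ ∷ ds₀))))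
        (l , r , trans (at-++ T v at-v p) at-p , hl , hr)

RestrictsTo : Subset k → Tree (Fin k) → (Fin k → Fin j) → Tree (Fin j) → Set
RestrictsTo {k} Y t φ K = Σ (Tree (Fin k)) λ t′ → restrict Y t ≡ just t′ × mapT φ t′ ≅ K

-- For A = left 𝒯, B = right 𝒯 these unfold to RestrictIso 𝒯 and CrossResponsible 𝒯.
PairRestrictIso : Tree (Fin k) → Tree (Fin k) → Subset k → Tree (Fin j) → Tree (Fin j) → Set
PairRestrictIso {k} {j} A B Y KL KR = Σ (Fin k → Fin j) λ φ → RestrictsTo Y A φ KL × RestrictsTo Y B φ KR

PairCrossResponsible : Tree (Fin k) → Tree (Fin k) → Subset k → Set
PairCrossResponsible A B Y =
  PairRestrictIso A B Y K₁-left K₁-right ⊎ PairRestrictIso A B Y K₂-left K₂-right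

map-≅-just : (f : A → B) (x : Maybe (Tree A)) {z : Tree B} →
             Pointwise _≅_ (Maybe.map (mapT f) x) (just z) → ∃ λ w → x ≡ just w × mapT f w ≅ z
map-≅-just f (just w) (just p) = w , refl , p

_⁻¹_ : (Fin n → Fin k) → Subset k → Subset n
ψ ⁻¹ Y = tabulate (lookup Y ∘ ψ)

module _ (ψ : Fin n → Fin k) (S : Subset n) (Y : Subset k) where

  lookup-pullback : {a : Fin n} → a ∈ S → lookup (S ∩ ψ ⁻¹ Y) a ≡ lookup Y (ψ a)
  lookup-pullback {a} a∈S rewrite lookup-zipWith _∧_ a S (ψ ⁻¹ Y) | []=⇒lookup a∈S =
    lookup∘tabulate (lookup Y ∘ ψ) a

  ∈-pullback : {a : Fin n} → a ∈ S → ψ a ∈ Y → a ∈ S ∩ ψ ⁻¹ Y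
  ∈-pullback {a} a∈S ψa∈Y =
    x∈p∩q⁺ (a∈S , lookup⇒[]= a (ψ ⁻¹ Y)
                    (trans (lookup∘tabulate (lookup Y ∘ ψ) a) ([]=⇒lookup ψa∈Y)))

  RestrictsTo-∘ : {t : Tree (Fin n)} {t₅ : Tree (Fin k)} {φ : Fin k → Fin j} {K : Tree (Fin j)} →
                  RestrictsTo S t ψ t₅ → RestrictsTo Y t₅ φ K → RestrictsTo (S ∩ ψ ⁻¹ Y) t (φ ∘ ψ) K
  RestrictsTo-∘ {t = t} {φ = φ} {K = K} (A , t↦A , ψA≅t₅) (z , t₅↦z , φz≅K)
    with w , A↦w , ψw≅z ← map-≅-just ψ (restrict (S ∩ ψ ⁻¹ Y) A)
           (subst₂ (Pointwise _≅_)
             (sym (restrict-mapT ψ (S ∩ ψ ⁻¹ Y) Y A (lookup-pullback ∘ restrict-⊆ S t t↦A)))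
             t₅↦z (restrict-≅ Y ψA≅t₅))
    = w , t↦w , subst (_≅ K) (mapT-∘ φ ψ w) (≅-trans (mapT-≅ φ ψw≅z) φz≅K)
    where
    open ≡-Reasoning
    t↦w : restrict (S ∩ ψ ⁻¹ Y) t ≡ just w
    t↦w = begin
      restrict (S ∩ ψ ⁻¹ Y) t                 ≡⟨ restrict-restrict (p∩q⊆p S (ψ ⁻¹ Y)) t ⟩
      (restrict S t >>= restrict (S ∩ ψ ⁻¹ Y)) ≡⟨ cong (_>>= restrict (S ∩ ψ ⁻¹ Y)) t↦A ⟩
      restrict (S ∩ ψ ⁻¹ Y) A                 ≡⟨ A↦w ⟩
      just w                                  ∎

  PairCrossResponsible-∘ : (t u : Tree (Fin n)) {t₅ u₅ : Tree (Fin k)} →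
                           RestrictsTo S t ψ t₅ → RestrictsTo S u ψ u₅ →
                           PairCrossResponsible t₅ u₅ Y → PairCrossResponsible t u (S ∩ ψ ⁻¹ Y)
  PairCrossResponsible-∘ t u {t₅} {u₅} t↦ u↦ = Sum.map pull pull
    where
    pull : {KL KR : Tree (Fin 4)} → PairRestrictIso t₅ u₅ Y KL KR → PairRestrictIso t u (S ∩ ψ ⁻¹ Y) KL KR
    pull (φ , t₅↦ , u₅↦) =
      φ ∘ ψ , RestrictsTo-∘ {t = t} t↦ t₅↦ , RestrictsTo-∘ {t = u} u↦ u₅↦

extend : (Fin n → Fin k) → Fin n → Fin n → Fin (suc k)
extend {k = k} φ m = updateAt (inject₁ ∘ φ) m (const (fromℕ k))

extend-new : (φ : Fin n → Fin k) (m : Fin n) → extend φ m m ≡ fromℕ k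
extend-new φ m = updateAt-updates m (inject₁ ∘ φ)

Cherry-RestrictsTo : {Y : Subset n} {t : Tree (Fin n)} {φ : Fin n → Fin k} {K : Tree (Fin k)} {a b : Fin n} →
                     AnyMaybe (Cherry a b) (restrict Y t) → RestrictsTo Y t φ K → Cherry (φ a) (φ b) K
Cherry-RestrictsTo {φ = φ} c (t′ , Y↦t′ , φt′≅K) with just c′ ← subst (AnyMaybe _) Y↦t′ c =
  Cherry-≅ (Cherry-mapT φ c′) φt′≅K

module _ (X : Subset n) (φ : Fin n → Fin k) {m : Fin n} (m∉X : m ∉ X) where

  extend-≅ : (t : Tree (Fin n)) {tX : Tree (Fin n)} {K : Tree (Fin k)} →
             restrict X t ≡ just tX → mapT φ tX ≅ K → mapT (extend φ m) tX ≅ mapT inject₁ K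
  extend-≅ t {tX} {K} X↦tX φtX≅K =
    subst (_≅ mapT inject₁ K) (sym extend≡inject₁∘φ) (mapT-≅ inject₁ φtX≅K)
    where
    open ≡-Reasoning
    extend≡inject₁∘φ : mapT (extend φ m) tX ≡ mapT inject₁ (mapT φ tX)
    extend≡inject₁∘φ = begin
      mapT (extend φ m) tX    ≡⟨ mapT-cong (extend φ m) tX (λ a∈tX → updateAt-minimal _ m _ λ { refl →
                                   m∉X (restrict-⊆ X t X↦tX a∈tX) }) ⟩
      mapT (inject₁ ∘ φ) tX   ≡⟨ mapT-∘ inject₁ φ tX ⟨
      mapT inject₁ (mapT φ tX) ∎

  RestrictsTo-insert : (t : Tree (Fin n)) → Unique (leaves t) → m ∈ₗ leaves t → {K : Tree (Fin k)} →
                       RestrictsTo X t φ K →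
                       ∃ λ t₅ → t₅ ∈ₗ insertions (fromℕ k) (mapT inject₁ K) ×
                                RestrictsTo (X [ m ]≔ inside) t (extend φ m) t₅
  RestrictsTo-insert t u m∈t (tX , X↦tX , φtX≅K)
    with restrict (X [ m ]≔ inside) t
       | subst (λ x → Insertionᴹ m x (restrict (X [ m ]≔ inside) t)) X↦tX (restrict-insert X m∉X t u m∈t)
  ... | nothing | ()
  ... | just A  | tX↝A
    with A₅ , tX₅↝A₅ , A≅A₅ ← Insertion-≅
           (subst (λ a → Insertion a (mapT (extend φ m) tX) (mapT (extend φ m) A)) (extend-new φ m)
                  (Insertion-mapT (extend φ m) tX↝A))
           (extend-≅ t X↦tX φtX≅K)
    = A₅ , insertions-complete tX₅↝A₅ , A , refl , A≅A₅

-- Exchanging the two trees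

swap : Tanglegram n → Tanglegram n
swap 𝒯 = record { left        = right 𝒯        ; right        = left 𝒯
                ; left-leaves = right-leaves 𝒯 ; right-leaves = left-leaves 𝒯 }

RestrictsTo-relabel : {Y : Subset n} {t : Tree (Fin n)} {φ : Fin n → Fin j} {K : Tree (Fin j)}
                      (h : Fin j → Fin k) → RestrictsTo Y t φ K → RestrictsTo Y t (h ∘ φ) (mapT h K)
RestrictsTo-relabel {φ = φ} h (t′ , Y↦t′ , φt′≅K) =
  t′ , Y↦t′ , subst (_≅ _) (mapT-∘ h φ t′) (mapT-≅ h φt′≅K)

RestrictIso-swap : {𝒯 : Tanglegram n} {Y : Subset n} {KL KR : Tree (Fin j)} (h : Fin j → Fin k) →
                   RestrictIso 𝒯 Y KL KR → RestrictIso (swap 𝒯) Y (mapT h KR) (mapT h KL)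
RestrictIso-swap {𝒯 = 𝒯} h (φ , Y↦KL , Y↦KR) =
  h ∘ φ , RestrictsTo-relabel {t = right 𝒯} h Y↦KR , RestrictsTo-relabel {t = left 𝒯} h Y↦KL

-- Exchanging the two trees of 𝒦₁ (of 𝒦₂) is undone by exchanging the labels l₂, l₃ (l₁, l₄).
CrossResponsible-swap : {𝒯 : Tanglegram n} {Y : Subset n} →
                        CrossResponsible (swap 𝒯) Y → CrossResponsible 𝒯 Y
CrossResponsible-swap {𝒯 = 𝒯} (inj₁ ρ) = inj₁ (RestrictIso-swap {𝒯 = swap 𝒯} (transpose l₂ l₃) ρ)
CrossResponsible-swap {𝒯 = 𝒯} (inj₂ ρ) = inj₂ (RestrictIso-swap {𝒯 = swap 𝒯} (transpose l₁ l₄) ρ)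

-- The five-leaf extensions of 𝒦₁

iso? : (t u : Tree (Fin k)) → Maybe (t ≅ u)
iso? (leaf a) (leaf b) with a ≟ b
... | yes refl = just (leaf≅ a)
... | no _     = nothing
iso? (node l r) (node l′ r′) =
  Maybe.map (λ (p , q) → node≅ p q) (zip (iso? l l′) (iso? r r′)) <∣>
  Maybe.map (λ (p , q) → swap≅ p q) (zip (iso? l r′) (iso? r l′))
iso? _ _ = nothing

restrictsTo? : (Y : Subset k) (t : Tree (Fin k)) (φ : Fin k → Fin j) (K : Tree (Fin j)) →
               Maybe (RestrictsTo Y t φ K)
restrictsTo? Y t φ K with restrict Y t
... | nothing = nothing
... | just z  = Maybe.map (λ p → z , refl , p) (iso? (mapT φ z) K)

pairCrossResponsible? : (A B : Tree (Fin k)) (Y : Subset k) (φ : Fin k → Fin 4) →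
                        Maybe (PairCrossResponsible A B Y)
pairCrossResponsible? A B Y φ =
  Maybe.map (λ (a , b) → inj₁ (φ , a , b))
            (zip (restrictsTo? Y A φ K₁-left) (restrictsTo? Y B φ K₁-right)) <∣>
  Maybe.map (λ (a , b) → inj₂ (φ , a , b))
            (zip (restrictsTo? Y A φ K₂-left) (restrictsTo? Y B φ K₂-right))

permutations : (k : ℕ) → List (Fin k → Fin k)
permutations zero    = (λ ()) ∷ []
permutations (suc k) =
  concatMap (λ i → map (λ π → λ { zero → i ; (suc a) → punchIn i (π a) }) (permutations k))
            (allFin (suc k))

l₅ : Fin 5
l₅ = fromℕ 4

-- pinch j collapses inject₁ j and suc j, so π ∘ pinch j maps the complement of inject₁ j
-- bijectively onto Fin 4: these are all relabellings of four-element sets Y ∋ l₅.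
relabellings : List (Subset 5 × (Fin 5 → Fin 4))
relabellings = concatMap (λ j → map (λ π → ∁ ⁅ inject₁ j ⁆ , π ∘ pinch j) (permutations 4)) (allFin 4)

CrossResponsibleWithNew : Tree (Fin 5) → Tree (Fin 5) → Set
CrossResponsibleWithNew A B = ∃ λ Y → l₅ ∈ Y × PairCrossResponsible A B Y

crossResponsibleWithNew? : (A B : Tree (Fin 5)) → Maybe (CrossResponsibleWithNew A B)
crossResponsibleWithNew? A B = head (mapMaybe try relabellings)
  where
  try : Subset 5 × (Fin 5 → Fin 4) → Maybe (CrossResponsibleWithNew A B)
  try (Y , φ) with l₅ ∈? Y
  ... | yes l₅∈Y = Maybe.map (λ cr → Y , l₅∈Y , cr) (pairCrossResponsible? A B Y φ)
  ... | no _     = nothing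

isCherryWith : Fin k → Tree (Fin k) → Tree (Fin k) → Bool
isCherryWith a (leaf b) (leaf c) = ⌊ a ≟ b ⌋ ∨ ⌊ a ≟ c ⌋
isCherryWith a _        _        = false

hasCherryWith : Fin k → Tree (Fin k) → Bool
hasCherryWith a (leaf _)   = false
hasCherryWith a (node l r) = isCherryWith a l r ∨ hasCherryWith a l ∨ hasCherryWith a r

Cherry⇒hasCherryWith : {a b : Fin k} {t : Tree (Fin k)} → Cherry a b t → T (hasCherryWith a t)
Cherry⇒hasCherryWith {a = a} {b} cherryᵃᵇ =
  Equivalence.from T-∨ (inj₁ (Equivalence.from (T-∨ {⌊ a ≟ a ⌋}) (inj₁ (fromWitness refl))))
Cherry⇒hasCherryWith {a = a} {b} cherryᵇᵃ =
  Equivalence.from T-∨ (inj₁ (Equivalence.from (T-∨ {⌊ a ≟ b ⌋}) (inj₂ (fromWitness refl))))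
Cherry⇒hasCherryWith {a = a} (thereˡ {l} {r} c) =
  Equivalence.from (T-∨ {isCherryWith a l r}) (inj₂ (Equivalence.from T-∨ (inj₁ (Cherry⇒hasCherryWith c))))
Cherry⇒hasCherryWith {a = a} (thereʳ {l} {r} c) =
  Equivalence.from (T-∨ {isCherryWith a l r})
    (inj₂ (Equivalence.from (T-∨ {hasCherryWith a l}) (inj₂ (Cherry⇒hasCherryWith c))))

cherry⇒crossResponsibleWithNew? : (A B : Tree (Fin 5)) →
                                  Maybe (T (hasCherryWith l₅ A) → CrossResponsibleWithNew A B)
cherry⇒crossResponsibleWithNew? A B with hasCherryWith l₅ A
... | false = just λ ()
... | true  = Maybe.map const (crossResponsibleWithNew? A B)

K₁-leftExtensions K₁-rightExtensions : List (Tree (Fin 5))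
K₁-leftExtensions  = insertions l₅ (mapT inject₁ K₁-left)
K₁-rightExtensions = insertions l₅ (mapT inject₁ K₁-right)

extensionChecked : Tree (Fin 5) → Tree (Fin 5) → Bool
extensionChecked A B = is-just (cherry⇒crossResponsibleWithNew? A B)

K₁-extensions-checked : T (all (λ A → all (extensionChecked A) K₁-rightExtensions) K₁-leftExtensions)
K₁-extensions-checked = tt

K₁-extension-crossResponsible : {A B : Tree (Fin 5)} {s : Fin 5} →
  A ∈ₗ K₁-leftExtensions → B ∈ₗ K₁-rightExtensions → Cherry l₅ s A → CrossResponsibleWithNew A B
K₁-extension-crossResponsible {A} {B} A∈ B∈ cherry =
  to-witness-T (cherry⇒crossResponsibleWithNew? A B)
    (All.lookup (All.all⁺ (extensionChecked A) K₁-rightExtensions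
      (All.lookup (All.all⁺ (λ A → all (extensionChecked A) K₁-rightExtensions) K₁-leftExtensions
                            K₁-extensions-checked) A∈)) B∈)
    (Cherry⇒hasCherryWith cherry)

no-left-scar-on-leaf-edge : (𝒯 : Tanglegram n) (X : Subset n) → (∀ Y → CrossResponsible 𝒯 Y → Y ≡ X) →
                            RestrictIso 𝒯 X K₁-left K₁-right →
                            (m : Fin n) → m ∉ X → ¬ ScarOnLeafEdge X (left 𝒯) m
no-left-scar-on-leaf-edge 𝒯 X unique (φ , X↦K₁ˡ , X↦K₁ʳ) m m∉X scar =
  let uL = leaves-Unique (left 𝒯) (left-leaves 𝒯)
      uR = leaves-Unique (right 𝒯) (right-leaves 𝒯)
      s , cherry = scar⇒cherry X m∉X (left 𝒯) uL scar
      A₅ , A₅∈ , X⁺↦A₅ =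
        RestrictsTo-insert X φ m∉X (left 𝒯) uL (leaves-complete (left 𝒯) (left-leaves 𝒯) m) X↦K₁ˡ
      B₅ , B₅∈ , X⁺↦B₅ =
        RestrictsTo-insert X φ m∉X (right 𝒯) uR (leaves-complete (right 𝒯) (right-leaves 𝒯) m) X↦K₁ʳ
      new-cherry = subst (λ a → Cherry a (extend φ m s) A₅) (extend-new φ m)
                         (Cherry-RestrictsTo {t = left 𝒯} cherry X⁺↦A₅)
      Y₅ , l₅∈Y₅ , Y₅-crossResponsible = K₁-extension-crossResponsible A₅∈ B₅∈ new-cherry
      Y = (X [ m ]≔ inside) ∩ extend φ m ⁻¹ Y₅
      m∈Y = ∈-pullback (extend φ m) _ Y₅ ([]≔-updates X m)
                       (subst (_∈ Y₅) (sym (extend-new φ m)) l₅∈Y₅)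
      Y≡X = unique Y (PairCrossResponsible-∘ (extend φ m) _ Y₅ (left 𝒯) (right 𝒯)
                                              X⁺↦A₅ X⁺↦B₅ Y₅-crossResponsible)
  in m∉X (subst (m ∈_) Y≡X m∈Y)

lemma6 : {n : ℕ} (𝒯 : Tanglegram n) (X : Subset n) →
    CrossResponsible 𝒯 X →
    (∀ Y → CrossResponsible 𝒯 Y → Y ≡ X) →
    RestrictIso 𝒯 X K₁-left K₁-right →
    (m : Fin n) → m ∉ X →
    ¬ ScarOnLeafEdge X (left 𝒯) m × ¬ ScarOnLeafEdge X (right 𝒯) m
lemma6 𝒯 X _ unique X↦K₁ m m∉X =
  no-left-scar-on-leaf-edge 𝒯 X unique X↦K₁ m m∉X ,
  no-left-scar-on-leaf-edge (swap 𝒯) X (λ Y → unique Y ∘ CrossResponsible-swap {𝒯 = 𝒯})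
    (RestrictIso-swap {𝒯 = 𝒯} (transpose l₂ l₃) X↦K₁) m m∉X
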